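{- Let $A$ be an abelian group and $G$ an $A$-vertex magic graph. If $0\in spec(G,A)$, then $G$ has no pendant vertices (vertices of degree $1$).
   Context: All graphs are finite and simple. For an additive abelian group $A$ with identity $0$ and a graph $G$, an $A$-vertex magic labeling of $G$ is a map $l:V(G)\to A\setminus\{0\}$ for which there is $\mu\in A$ (the magic constant) such that $w(v):=\sum_{u\in N_G(v)} l(u)=\mu$ for every $v\in V(G)$. $G$ is $A$-vertex magic if such a labeling exists. $spec(G,A)$ denotes the set of all magic constants of $A$-vertex magic labelings of $G$. -}

module Defs where

open import Level using (Level)
open import Data.Nat using (ℕ; zero; suc)
open import Data.Fin using (Fin; zero; suc)
open import Data.Bool using (Bool; true; false; if_then_else_)
open import Data.Product using (Σ; _×_; ∃)
open import Relation.Binary.PropositionalEquality using (_≡_)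
open import Relation.Nullary using (¬_)
open import Algebra.Bundles using (AbelianGroup)

record SimpleGraph (n : ℕ) : Set where
  field
    adj     : Fin n → Fin n → Bool
    symm    : ∀ u v → adj u v ≡ adj v u
    irrefl  : ∀ v → adj v v ≡ false

open SimpleGraph public

count : ∀ {n} → (Fin n → Bool) → ℕ
count {zero}  p = 0
count {suc n} p = (if p zero then 1 else 0) Data.Nat.+ count (λ i → p (suc i))

degree : ∀ {n} → SimpleGraph n → Fin n → ℕ
degree G v = count (adj G v)

module _ {c ℓ : Level} (A : AbelianGroup c ℓ) where
  open AbelianGroup A

  ∑ : ∀ {n} → (Fin n → Carrier) → Carrier
  ∑ {zero}  f = ε
  ∑ {suc n} f = f zero ∙ ∑ (λ i → f (suc i))

  weight : ∀ {n} → SimpleGraph n → (Fin n → Carrier) → Fin n → Carrier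
  weight G l v = ∑ (λ u → if adj G v u then l u else ε)

  IsVertexMagicLabeling : ∀ {n} → SimpleGraph n → (Fin n → Carrier) → Carrier → Set ℓ
  IsVertexMagicLabeling G l μ = (∀ u → ¬ (l u ≈ ε)) × (∀ v → weight G l v ≈ μ)

  InSpec : ∀ {n} → SimpleGraph n → Carrier → Set (c Level.⊔ ℓ)
  InSpec {n} G μ = Σ (Fin n → Carrier) (λ l → IsVertexMagicLabeling G l μ)

  IsVertexMagic : ∀ {n} → SimpleGraph n → Set (c Level.⊔ ℓ)
  IsVertexMagic G = ∃ (λ μ → InSpec G μ)

{-# OPTIONS --safe #-}
module Submission where

-- The weight of a pendant vertex is the label of its unique neighbour, which
-- is nonzero, so the weight cannot be the magic constant 0.

open import Defs
open import Level using (Level)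
open import Data.Nat using (ℕ; zero; suc)
open import Data.Nat.Properties using (suc-injective)
open import Data.Fin using (Fin; zero; suc)
open import Data.Bool using (Bool; true; false; if_then_else_)
open import Data.Product using (Σ; _,_)
open import Relation.Binary.PropositionalEquality using (_≡_; _≢_)
open import Algebra.Bundles using (AbelianGroup)

module _ {c ℓ : Level} (A : AbelianGroup c ℓ) where
  open AbelianGroup A

  ∑-mask : ∀ {n} → (Fin n → Bool) → (Fin n → Carrier) → Carrier
  ∑-mask p f = ∑ A (λ u → if p u then f u else ε)

  ∑-mask-count≡0 : ∀ {n} (p : Fin n → Bool) (f : Fin n → Carrier) →
                   count p ≡ 0 → ∑-mask p f ≈ ε
  ∑-mask-count≡0 {zero}  p f _ = refl
  ∑-mask-count≡0 {suc n} p f e with p zero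
  ∑-mask-count≡0 {suc n} p f () | true
  ∑-mask-count≡0 {suc n} p f e  | false =
    trans (identityˡ _) (∑-mask-count≡0 (λ i → p (suc i)) (λ i → f (suc i)) e)

  ∑-mask-count≡1 : ∀ {n} (p : Fin n → Bool) (f : Fin n → Carrier) →
                   count p ≡ 1 → Σ (Fin n) (λ u → ∑-mask p f ≈ f u)
  ∑-mask-count≡1 {suc n} p f e with p zero
  ... | true  = zero , trans (∙-congˡ rest≈ε) (identityʳ (f zero))
    where
    rest≈ε : ∑-mask (λ i → p (suc i)) (λ i → f (suc i)) ≈ ε
    rest≈ε = ∑-mask-count≡0 (λ i → p (suc i)) (λ i → f (suc i)) (suc-injective e)
  ... | false with ∑-mask-count≡1 (λ i → p (suc i)) (λ i → f (suc i)) e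
  ...   | u , rest≈fu = suc u , trans (identityˡ _) rest≈fu

  weight-pendant : ∀ {n} (G : SimpleGraph n) (l : Fin n → Carrier) (v : Fin n) →
                   degree G v ≡ 1 → Σ (Fin n) (λ u → weight A G l v ≈ l u)
  weight-pendant G l v = ∑-mask-count≡1 (adj G v) l

mainTheorem7 : ∀ {c ℓ : Level} (A : AbelianGroup c ℓ) {n : ℕ} (G : SimpleGraph n) →
                 IsVertexMagic A G →
                 InSpec A G (AbelianGroup.ε A) →
                 ∀ (v : Fin n) → degree G v ≢ 1
mainTheorem7 A G _ (l , l≉0 , w≈0) v deg≡1 with weight-pendant A G l v deg≡1
... | u , wv≈lu = l≉0 u (trans (sym wv≈lu) (w≈0 v))
  where open AbelianGroup A using (trans; sym)
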